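{- Let $\pi$ and $\tau$ be chromosomes. If $\mathcal{A}[\pi]\neq\mathcal{A}[\tau]$, then $\pi$ cannot be transformed into $\tau$ by a sequence of symmetric reversals.
   Context: Fix genes $\Sigma_1$ and repeats $\Sigma_2\ni r_0$. A chromosome is a sequence $\pi=[x_0,\dots,x_{n+1}]$ of signed symbols ($x_i=\pm a$, $|x_i|=a$) with $x_0=+r_0$, $x_{n+1}=-r_0$, every gene occurring exactly once. A symmetric reversal $\rho(i,j)$ ($0\le i<j\le n+1$, $x_i=-x_j$) replaces $x_i,\dots,x_j$ by $-x_j,\dots,-x_i$. Each occurrence $x_i$ has nodes $l(x_i),r(x_i)$: $(a^h,a^t)$ if $x_i=+a$, $(a^t,a^h)$ if $x_i=-a$. $\mathcal{A}[\pi]$ is the multiset of unordered pairs $\langle r(x_i),l(x_{i+1})\rangle$, $0\le i\le n$ (adjacencies). -}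

module Defs where

open import Data.Nat using (ℕ; zero; suc; _<_)
open import Data.Fin using (Fin; toℕ)
open import Data.List using (List; []; _∷_; _++_; [_]; take; drop; reverse; map; length; lookup)
open import Data.Product using (Σ; ∃; _×_; _,_)
open import Data.Sum using (_⊎_; inj₁; inj₂)
open import Relation.Binary.PropositionalEquality using (_≡_; refl; sym; trans)
open import Relation.Binary.Bundles using (Setoid)
open import Relation.Binary.Structures using (IsEquivalence)
open import Relation.Binary.Construct.Closure.ReflexiveTransitive using (Star)
import Data.List.Relation.Binary.Permutation.Setoid as PermS

data Sign : Set where
  plus minus : Sign

flip : Sign → Sign
flip plus = minus
flip minus = plus

data End : Set where
  hd tl : End

module Genome (Σ₁ Σ₂ : Set) (r₀ : Σ₂) where

  -- symbols: genes (Σ₁) and repeats (Σ₂), disjoint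
  Sym : Set
  Sym = Σ₁ ⊎ Σ₂

  SSym : Set
  SSym = Sign × Sym

  ∣_∣ : SSym → Sym
  ∣ (_ , a) ∣ = a

  neg : SSym → SSym
  neg (s , a) = (flip s , a)

  Node : Set
  Node = Sym × End

  lnode rnode : SSym → Node
  lnode (plus , a) = (a , hd)
  lnode (minus , a) = (a , tl)
  rnode (plus , a) = (a , tl)
  rnode (minus , a) = (a , hd)

  record Chromosome : Set where
    field
      inner : List SSym
    seq : List SSym
    seq = (plus , inj₂ r₀) ∷ (inner ++ [ (minus , inj₂ r₀) ])
    field
      genes-once : (g : Σ₁) →
        Σ (Fin (length seq)) λ i →
          (∣ lookup seq i ∣ ≡ inj₁ g) ×
          ((j : Fin (length seq)) → ∣ lookup seq j ∣ ≡ inj₁ g → j ≡ i)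
  open Chromosome public

  UPair : Set
  UPair = Node × Node

  _≈ᵤ_ : UPair → UPair → Set
  (a , b) ≈ᵤ (c , d) = ((a ≡ c) × (b ≡ d)) ⊎ ((a ≡ d) × (b ≡ c))

  UPairSetoid : Setoid _ _
  UPairSetoid = record
    { Carrier = UPair
    ; _≈_ = _≈ᵤ_
    ; isEquivalence = record
      { refl = inj₁ (refl , refl)
      ; sym = λ { (inj₁ (p , q)) → inj₁ (sym p , sym q)
                ; (inj₂ (p , q)) → inj₂ (sym q , sym p) }
      ; trans = λ { (inj₁ (p , q)) (inj₁ (p' , q')) → inj₁ (trans p p' , trans q q')
                  ; (inj₁ (p , q)) (inj₂ (p' , q')) → inj₂ (trans p p' , trans q q')
                  ; (inj₂ (p , q)) (inj₁ (p' , q')) → inj₂ (trans p q' , trans q p')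
                  ; (inj₂ (p , q)) (inj₂ (p' , q')) → inj₁ (trans p q' , trans q p') }
      }
    }

  open PermS UPairSetoid public using () renaming (_↭_ to _≋ₘ_)

  -- the adjacencies ⟨r(x_i), l(x_{i+1})⟩, 0 ≤ i ≤ n, as a list (read as a multiset)
  adjList : List SSym → List UPair
  adjList (x ∷ y ∷ rest) = (rnode x , lnode y) ∷ adjList (y ∷ rest)
  adjList _ = []

  𝒜 : Chromosome → List UPair
  𝒜 π = adjList (seq π)

  reverseSeg : ℕ → ℕ → List SSym → List SSym
  reverseSeg i j xs =
    take i xs ++ (reverse (map neg (drop i (take (suc j) xs))) ++ drop (suc j) xs)

  SymRev : List SSym → List SSym → Set
  SymRev xs ys =
    Σ (Fin (length xs)) λ i → Σ (Fin (length xs)) λ j →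
      (toℕ i < toℕ j) ×
      (lookup xs i ≡ neg (lookup xs j)) ×
      (ys ≡ reverseSeg (toℕ i) (toℕ j) xs)

  Transformable : Chromosome → Chromosome → Set
  Transformable π τ = Star SymRev (seq π) (seq τ)

-- A symmetric reversal ρ(i,j) fixes its two end symbols (x_i = -x_j) and
-- reverses and negates the stretch strictly between them. The adjacencies
-- outside the stretch are untouched, and the chain of adjacencies through the
-- stretch, from r(x_i) to l(x_j), is read backwards; since r(x_i) = r(-x_j) =
-- l(x_j), the backwards chain joins the same two nodes, so as a multiset of
-- unordered pairs nothing changes.
module Submission where

open import Defs
open import Relation.Nullary using (¬_)
open import Data.Nat using (suc; _<_; s≤s)
open import Data.Fin using (Fin; toℕ; zero; suc)
open import Data.List using (List; []; _∷_; _++_; [_]; _∷ʳ_; take; drop; reverse; map; length; lookup)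
open import Data.List.Properties using (++-assoc; map-++; reverse-++; unfold-reverse; take-suc; take++drop≡id)
open import Data.Product using (_,_)
open import Data.Sum using (inj₁; inj₂)
open import Relation.Binary.PropositionalEquality using (_≡_; refl; trans; cong; cong₂; module ≡-Reasoning)
open import Relation.Binary.Construct.Closure.ReflexiveTransitive using (Star; fold)
import Data.List.Relation.Binary.Permutation.Setoid as Perm
import Data.List.Relation.Binary.Permutation.Setoid.Properties as PermProperties

reverse-∷-∷ʳ : ∀ {A : Set} (x : A) xs y → reverse (x ∷ xs ∷ʳ y) ≡ y ∷ reverse xs ∷ʳ x
reverse-∷-∷ʳ x xs y = trans (reverse-++ (x ∷ xs) [ y ]) (cong (y ∷_) (unfold-reverse x xs))

module _ {Σ₁ Σ₂ : Set} {r₀ : Σ₂} where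
  open Genome Σ₁ Σ₂ r₀
  open Perm UPairSetoid using (↭-refl; ↭-sym; ↭-trans; prep; module PermutationReasoning)
  open PermProperties UPairSetoid using (++⁺ʳ; ↭-reverse)

  neg-involutive : ∀ x → neg (neg x) ≡ x
  neg-involutive (plus , a) = refl
  neg-involutive (minus , a) = refl

  lnode-neg : ∀ x → lnode (neg x) ≡ rnode x
  lnode-neg (plus , a) = refl
  lnode-neg (minus , a) = refl

  rnode-neg : ∀ x → rnode (neg x) ≡ lnode x
  rnode-neg (plus , a) = refl
  rnode-neg (minus , a) = refl

  swap : UPair → UPair
  swap (u , v) = (v , u)

  map-swap↭ : ∀ ps → map swap ps ≋ₘ ps
  map-swap↭ [] = ↭-refl
  map-swap↭ (p ∷ ps) = prep (inj₂ (refl , refl)) (map-swap↭ ps)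

  adjBetween : Node → List SSym → Node → List UPair
  adjBetween u [] v = [ (u , v) ]
  adjBetween u (x ∷ xs) v = (u , lnode x) ∷ adjBetween (rnode x) xs v

  adjBetween-∷ʳ : ∀ u xs y v →
    adjBetween u (xs ∷ʳ y) v ≡ adjBetween u xs (lnode y) ∷ʳ (rnode y , v)
  adjBetween-∷ʳ u [] y v = refl
  adjBetween-∷ʳ u (x ∷ xs) y v = cong ((u , lnode x) ∷_) (adjBetween-∷ʳ (rnode x) xs y v)

  adjBetween-reverse : ∀ u xs v →
    adjBetween u (reverse (map neg xs)) v ≡ reverse (map swap (adjBetween v xs u))
  adjBetween-reverse u [] v = refl
  adjBetween-reverse u (x ∷ xs) v = begin
    adjBetween u (reverse (map neg (x ∷ xs))) v
      ≡⟨ cong (λ ws → adjBetween u ws v) (unfold-reverse (neg x) (map neg xs)) ⟩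
    adjBetween u (reverse (map neg xs) ∷ʳ neg x) v
      ≡⟨ adjBetween-∷ʳ u (reverse (map neg xs)) (neg x) v ⟩
    adjBetween u (reverse (map neg xs)) (lnode (neg x)) ∷ʳ (rnode (neg x) , v)
      ≡⟨ cong₂ (λ w w′ → adjBetween u (reverse (map neg xs)) w ∷ʳ (w′ , v)) (lnode-neg x) (rnode-neg x) ⟩
    adjBetween u (reverse (map neg xs)) (rnode x) ∷ʳ (lnode x , v)
      ≡⟨ cong (_∷ʳ (lnode x , v)) (adjBetween-reverse u xs (rnode x)) ⟩
    reverse (map swap (adjBetween (rnode x) xs u)) ∷ʳ (lnode x , v)
      ≡⟨ unfold-reverse (lnode x , v) (map swap (adjBetween (rnode x) xs u)) ⟨
    reverse (map swap (adjBetween v (x ∷ xs) u))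
      ∎
    where open ≡-Reasoning

  adjBetween-reverse↭ : ∀ u xs v → u ≡ v →
    adjBetween u xs v ≋ₘ adjBetween u (reverse (map neg xs)) v
  adjBetween-reverse↭ u xs .u refl = ↭-sym (begin
    adjBetween u (reverse (map neg xs)) u  ≡⟨ adjBetween-reverse u xs u ⟩
    reverse (map swap (adjBetween u xs u)) ↭⟨ ↭-reverse (map swap (adjBetween u xs u)) ⟩
    map swap (adjBetween u xs u)           ↭⟨ map-swap↭ (adjBetween u xs u) ⟩
    adjBetween u xs u                      ∎)
    where open PermutationReasoning

  adjList-∷-++-∷ : ∀ s xs t ys →
    adjList (s ∷ xs ++ t ∷ ys) ≡ adjBetween (rnode s) xs (lnode t) ++ adjList (t ∷ ys)
  adjList-∷-++-∷ s [] t ys = refl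
  adjList-∷-++-∷ s (x ∷ xs) t ys = cong ((rnode s , lnode x) ∷_) (adjList-∷-++-∷ x xs t ys)

  adjList-++⁺ˡ : ∀ zs {x xs ys} → adjList (x ∷ xs) ≋ₘ adjList (x ∷ ys) →
    adjList (zs ++ x ∷ xs) ≋ₘ adjList (zs ++ x ∷ ys)
  adjList-++⁺ˡ [] p = p
  adjList-++⁺ˡ (z ∷ []) p = prep (inj₁ (refl , refl)) p
  adjList-++⁺ˡ (z ∷ zs@(_ ∷ _)) p = prep (inj₁ (refl , refl)) (adjList-++⁺ˡ zs p)

  adjList-reverse-inner : ∀ zs s xs t ys → rnode s ≡ lnode t →
    adjList (zs ++ s ∷ xs ++ t ∷ ys) ≋ₘ adjList (zs ++ s ∷ reverse (map neg xs) ++ t ∷ ys)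
  adjList-reverse-inner zs s xs t ys rs≡lt = adjList-++⁺ˡ zs (begin
    adjList (s ∷ xs ++ t ∷ ys)
      ≡⟨ adjList-∷-++-∷ s xs t ys ⟩
    adjBetween (rnode s) xs (lnode t) ++ adjList (t ∷ ys)
      ↭⟨ ++⁺ʳ (adjList (t ∷ ys)) (adjBetween-reverse↭ (rnode s) xs (lnode t) rs≡lt) ⟩
    adjBetween (rnode s) (reverse (map neg xs)) (lnode t) ++ adjList (t ∷ ys)
      ≡⟨ adjList-∷-++-∷ s (reverse (map neg xs)) t ys ⟨
    adjList (s ∷ reverse (map neg xs) ++ t ∷ ys)
      ∎)
    where open PermutationReasoning

  reverse-neg-ends : ∀ s xs t ys → s ≡ neg t →
    reverse (map neg (s ∷ xs ∷ʳ t)) ++ ys ≡ s ∷ reverse (map neg xs) ++ t ∷ ys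
  reverse-neg-ends .(neg t) xs t ys refl = begin
    reverse (map neg (neg t ∷ xs ∷ʳ t)) ++ ys
      ≡⟨ cong (λ ws → reverse (neg (neg t) ∷ ws) ++ ys) (map-++ neg xs [ t ]) ⟩
    reverse (neg (neg t) ∷ map neg xs ∷ʳ neg t) ++ ys
      ≡⟨ cong (_++ ys) (reverse-∷-∷ʳ (neg (neg t)) (map neg xs) (neg t)) ⟩
    neg t ∷ (reverse (map neg xs) ∷ʳ neg (neg t)) ++ ys
      ≡⟨ cong (λ w → neg t ∷ (reverse (map neg xs) ∷ʳ w) ++ ys) (neg-involutive t) ⟩
    neg t ∷ (reverse (map neg xs) ∷ʳ t) ++ ys
      ≡⟨ cong (neg t ∷_) (++-assoc (reverse (map neg xs)) [ t ] ys) ⟩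
    neg t ∷ reverse (map neg xs) ++ t ∷ ys
      ∎
    where open ≡-Reasoning

  record Segment (xs : List SSym) (i j : Fin (length xs)) : Set where
    field
      before middle after : List SSym
      split : xs ≡ before ++ lookup xs i ∷ middle ++ lookup xs j ∷ after
      reversed : reverseSeg (toℕ i) (toℕ j) xs
               ≡ before ++ reverse (map neg (lookup xs i ∷ middle ∷ʳ lookup xs j)) ++ after

  segment : ∀ xs (i j : Fin (length xs)) → toℕ i < toℕ j → Segment xs i j
  segment (x ∷ xs) zero (suc j) _ = record
    { before = []
    ; middle = take (toℕ j) xs
    ; after = drop (suc (toℕ j)) xs
    ; split = cong (x ∷_) (begin
        xs                                                     ≡⟨ take++drop≡id (suc (toℕ j)) xs ⟨
        take (suc (toℕ j)) xs ++ drop (suc (toℕ j)) xs         ≡⟨ cong (_++ drop (suc (toℕ j)) xs) (take-suc xs j) ⟩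
        (take (toℕ j) xs ∷ʳ lookup xs j) ++ drop (suc (toℕ j)) xs ≡⟨ ++-assoc (take (toℕ j) xs) [ lookup xs j ] _ ⟩
        take (toℕ j) xs ++ lookup xs j ∷ drop (suc (toℕ j)) xs ∎)
    ; reversed = cong (λ ws → reverse (map neg (x ∷ ws)) ++ drop (suc (toℕ j)) xs) (take-suc xs j)
    }
    where open ≡-Reasoning
  segment (x ∷ xs) (suc i) (suc j) (s≤s i<j) = record
    { before = x ∷ before
    ; middle = middle
    ; after = after
    ; split = cong (x ∷_) split
    ; reversed = cong (x ∷_) reversed
    }
    where open Segment (segment xs i j i<j)

  adjList-symRev : ∀ {xs ys} → SymRev xs ys → adjList xs ≋ₘ adjList ys
  adjList-symRev {xs} (i , j , i<j , xᵢ≡-xⱼ , refl) = begin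
    adjList xs
      ≡⟨ cong adjList split ⟩
    adjList (before ++ s ∷ middle ++ t ∷ after)
      ↭⟨ adjList-reverse-inner before s middle t after (trans (cong rnode xᵢ≡-xⱼ) (rnode-neg t)) ⟩
    adjList (before ++ s ∷ reverse (map neg middle) ++ t ∷ after)
      ≡⟨ cong (λ ws → adjList (before ++ ws)) (reverse-neg-ends s middle t after xᵢ≡-xⱼ) ⟨
    adjList (before ++ reverse (map neg (s ∷ middle ∷ʳ t)) ++ after)
      ≡⟨ cong adjList reversed ⟨
    adjList (reverseSeg (toℕ i) (toℕ j) xs)
      ∎
    where
    open Segment (segment xs i j i<j)
    open PermutationReasoning
    s t : SSym
    s = lookup xs i
    t = lookup xs j

  adjList-symRev⋆ : ∀ {xs ys} → Star SymRev xs ys → adjList xs ≋ₘ adjList ys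
  adjList-symRev⋆ = fold (λ xs ys → adjList xs ≋ₘ adjList ys) (λ r → ↭-trans (adjList-symRev r)) ↭-refl

theorem1 : (Σ₁ Σ₂ : Set) (r₀ : Σ₂) (π τ : Genome.Chromosome Σ₁ Σ₂ r₀) →
    ¬ Genome._≋ₘ_ Σ₁ Σ₂ r₀ (Genome.𝒜 Σ₁ Σ₂ r₀ π) (Genome.𝒜 Σ₁ Σ₂ r₀ τ) →
    ¬ Genome.Transformable Σ₁ Σ₂ r₀ π τ
theorem1 Σ₁ Σ₂ r₀ π τ 𝒜π≉𝒜τ π⇝τ = 𝒜π≉𝒜τ (adjList-symRev⋆ π⇝τ)
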